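{- Let $\Delta_{\mathrm{sur}}$ be the category whose objects are the finite linear orders $\langle n\rangle=\{0<1<\dots<n\}$ for $n\in\mathbb N$ and whose morphisms are surjective monotone functions. For each $n$, let $\mathsf{Deg}_n$ be the poset whose elements are the morphisms $f:\langle m\rangle\to\langle n\rangle$ of $\Delta_{\mathrm{sur}}$ with target $\langle n\rangle$ (for arbitrary $m$), ordered by $f\le g$ iff $f=g\circ h$ for some surjective monotone $h$ (the poset reflection of the slice category $\Delta_{\mathrm{sur}}/\langle n\rangle$). Then for every $n$, $\mathsf{Deg}_n$ has binary meets: for all $f,g$ there is an element $f\wedge g$ with $f\wedge g\le f$, $f\wedge g\le g$, and such that every $h$ with $h\le f$ and $h\le g$ satisfies $h\le f\wedge g$. -}

module Defs where

open import Data.Nat using (ℕ; suc)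
open import Data.Fin using (Fin; _≤_)
open import Data.Product using (Σ; ∃; _×_; _,_)
open import Relation.Binary.PropositionalEquality using (_≡_)

⟨_⟩ : ℕ → Set
⟨ n ⟩ = Fin (suc n)

Monotone : ∀ {m n} → (⟨ m ⟩ → ⟨ n ⟩) → Set
Monotone f = ∀ i j → i ≤ j → f i ≤ f j

Surjective : ∀ {m n} → (⟨ m ⟩ → ⟨ n ⟩) → Set
Surjective {m} {n} f = ∀ (y : ⟨ n ⟩) → Σ ⟨ m ⟩ (λ x → f x ≡ y)

record Hom (m n : ℕ) : Set where
  constructor hom
  field
    fun  : ⟨ m ⟩ → ⟨ n ⟩
    mono : Monotone fun
    surj : Surjective fun
open Hom public

Deg : ℕ → Set
Deg n = Σ ℕ (λ m → Hom m n)

_≼_ : ∀ {n} → Deg n → Deg n → Set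
_≼_ {n} (m , f) (k , g) = Σ (Hom m k) (λ h → ∀ x → fun f x ≡ fun g (fun h x))

HasBinaryMeets : ℕ → Set
HasBinaryMeets n = (f g : Deg n) → Σ (Deg n) (λ p →
  (p ≼ f) × (p ≼ g) × ((h : Deg n) → h ≼ f → h ≼ g → h ≼ p))

{-# OPTIONS --safe #-}
-- A surjective monotone map ⟨m⟩ → ⟨n⟩ is determined by the sizes of its n + 1 fibres,
-- which are intervals. It factors through another one g exactly when each of its fibres
-- is at least as large as the corresponding fibre of g (the factor then collapses the
-- surplus of each fibre), so Deg_n is the set of tuples of positive fibre sizes ordered
-- by reverse pointwise comparison, and the meet of f and g takes fibrewise maxima.
module Submission where

open import Defs
open import Data.Nat using (ℕ; zero; suc; z≤n; s≤s)
open import Data.Fin using (Fin; _≤_) renaming (zero to fz; suc to fs)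
open import Data.Fin.Properties using (0≢1+n; suc-injective; ≤-antisym)
open import Data.Product using (Σ; _,_; proj₁; proj₂)
open import Data.Empty using (⊥-elim)
open import Function using (_∘_; id)
open import Level using (0ℓ)
open import Relation.Binary.Bundles using (Preorder)
import Relation.Binary.Reasoning.Preorder as PreorderReasoning
open import Relation.Binary.PropositionalEquality

-- The points of ⟨m⟩ are read from 0 upwards: `stay` puts the current point into the
-- fibre of the next one, `step` closes the fibre of the current point.
data Word : ℕ → ℕ → Set where
  done : Word 0 0
  stay : ∀ {m n} → Word m n → Word (suc m) n
  step : ∀ {m n} → Word m n → Word (suc m) (suc n)

⟦_⟧ : ∀ {m n} → Word m n → ⟨ m ⟩ → ⟨ n ⟩
⟦ done   ⟧ _      = fz
⟦ stay w ⟧ fz     = fz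
⟦ stay w ⟧ (fs x) = ⟦ w ⟧ x
⟦ step w ⟧ fz     = fz
⟦ step w ⟧ (fs x) = fs (⟦ w ⟧ x)

⟦⟧-zero : ∀ {m n} (w : Word m n) → ⟦ w ⟧ fz ≡ fz
⟦⟧-zero done     = refl
⟦⟧-zero (stay w) = refl
⟦⟧-zero (step w) = refl

⟦⟧-monotone : ∀ {m n} (w : Word m n) → Monotone ⟦ w ⟧
⟦⟧-monotone done     _      _      _       = z≤n
⟦⟧-monotone (stay w) fz     _      _       = z≤n
⟦⟧-monotone (stay w) (fs i) (fs j) (s≤s p) = ⟦⟧-monotone w i j p
⟦⟧-monotone (step w) fz     _      _       = z≤n
⟦⟧-monotone (step w) (fs i) (fs j) (s≤s p) = s≤s (⟦⟧-monotone w i j p)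

⟦⟧-surjective : ∀ {m n} (w : Word m n) → Surjective ⟦ w ⟧
⟦⟧-surjective done     fz = fz , refl
⟦⟧-surjective (stay w) y with ⟦⟧-surjective w y
... | x , e = fs x , e
⟦⟧-surjective (step w) fz = fz , refl
⟦⟧-surjective (step w) (fs y) with ⟦⟧-surjective w y
... | x , e = fs x , cong fs e

toHom : ∀ {m n} → Word m n → Hom m n
toHom w = hom ⟦ w ⟧ (⟦⟧-monotone w) (⟦⟧-surjective w)

predFin : ∀ {n} → Fin (suc (suc n)) → Fin (suc n)
predFin fz     = fz
predFin (fs i) = i

predFin-mono : ∀ {n} {a b : Fin (suc (suc n))} → a ≤ b → predFin a ≤ predFin b
predFin-mono {a = fz}          _       = z≤n
predFin-mono {a = fs _} {fs _} (s≤s p) = p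

suc-predFin : ∀ {n} {i : Fin (suc n)} {a : Fin (suc (suc n))} → fs i ≤ a → fs (predFin a) ≡ a
suc-predFin {a = fs _} _ = refl

Hom-zero : ∀ {m n} (f : Hom m n) → fun f fz ≡ fz
Hom-zero f with surj f fz
... | x , fx≡0 = ≤-antisym (subst (fun f fz ≤_) fx≡0 (mono f fz x z≤n)) z≤n

dropStay : ∀ {m n} (f : Hom (suc m) n) → fun f (fs fz) ≡ fz → Hom m n
dropStay f f1≡0 = hom (fun f ∘ fs) (λ i j i≤j → mono f (fs i) (fs j) (s≤s i≤j)) surj′
  where
  surj′ : Surjective (fun f ∘ fs)
  surj′ y with surj f y
  ... | fz   , f0≡y = fz , trans f1≡0 (trans (sym (Hom-zero f)) f0≡y)
  ... | fs x , e    = x , e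

dropStep : ∀ {m n} → Hom (suc m) (suc n) → Hom m n
dropStep f = hom (predFin ∘ fun f ∘ fs) mono′ surj′
  where
  mono′ : Monotone (predFin ∘ fun f ∘ fs)
  mono′ i j i≤j = predFin-mono (mono f (fs i) (fs j) (s≤s i≤j))
  surj′ : Surjective (predFin ∘ fun f ∘ fs)
  surj′ y with surj f (fs y)
  ... | fz   , f0≡1+y = ⊥-elim (0≢1+n (trans (sym (Hom-zero f)) f0≡1+y))
  ... | fs x , e      = x , cong predFin e

normalForm : ∀ {m n} (f : Hom m n) → Σ (Word m n) λ w → ⟦ w ⟧ ≗ fun f
normalForm {zero} {zero} f = done , λ { fz → sym (Hom-zero f) }
normalForm {zero} {suc n} f with surj f (fs fz)
... | fz , f0≡1 = ⊥-elim (0≢1+n (trans (sym (Hom-zero f)) f0≡1))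
normalForm {suc m} f with fun f (fs fz) in f1≡
... | fz with normalForm (dropStay f f1≡)
...   | w , w≗ = stay w , λ { fz     → sym (Hom-zero f)
                            ; (fs x) → w≗ x }
normalForm {suc m} {suc n} f | fs _ with normalForm (dropStep f)
...   | w , w≗ = step w , λ { fz     → sym (Hom-zero f)
                            ; (fs x) → trans (cong fs (w≗ x)) (sucPred x) }
  where
  sucPred : ∀ x → fs (predFin (fun f (fs x))) ≡ fun f (fs x)
  sucPred x = suc-predFin (subst (_≤ fun f (fs x)) f1≡ (mono f (fs fz) (fs x) (s≤s z≤n)))

-- Every fibre of w is at least as large as the corresponding fibre of v. A surplus `stay`
-- of w is only admitted before a `step` or `done` of v, which makes derivations unique;
-- `stayˡ` recovers the unrestricted rule.
infix 4 _⊑_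
data _⊑_ : ∀ {m k n} → Word m n → Word k n → Set where
  done-done : done ⊑ done
  stay-stay : ∀ {m k n} {w : Word m n} {v : Word k n} → w ⊑ v → stay w ⊑ stay v
  stay-step : ∀ {m k n} {w : Word m (suc n)} {v : Word k n} → w ⊑ step v → stay w ⊑ step v
  stay-done : ∀ {m} {w : Word m 0} → w ⊑ done → stay w ⊑ done
  step-step : ∀ {m k n} {w : Word m n} {v : Word k n} → w ⊑ v → step w ⊑ step v

⊑-factorises : ∀ {m k n} {w : Word m n} {v : Word k n} → w ⊑ v →
               Σ (Word m k) λ u → ⟦ w ⟧ ≗ ⟦ v ⟧ ∘ ⟦ u ⟧
⊑-factorises done-done = done , λ { fz → refl }
⊑-factorises (stay-stay w⊑v) with ⊑-factorises w⊑v
... | u , E = step u , λ { fz → refl ; (fs x) → E x }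
⊑-factorises (stay-step w⊑v) with ⊑-factorises w⊑v
... | u , E = stay u , λ { fz → refl ; (fs x) → E x }
⊑-factorises (stay-done w⊑v) with ⊑-factorises w⊑v
... | u , E = stay u , λ { fz → refl ; (fs x) → E x }
⊑-factorises (step-step w⊑v) with ⊑-factorises w⊑v
... | u , E = step u , λ { fz → refl ; (fs x) → cong fs (E x) }

stayˡ : ∀ {m k n} {w : Word m n} {v : Word k n} → w ⊑ v → stay w ⊑ v
stayˡ done-done       = stay-done done-done
stayˡ (stay-stay w⊑v) = stay-stay (stayˡ w⊑v)
stayˡ (stay-step w⊑v) = stay-step (stay-step w⊑v)
stayˡ (stay-done w⊑v) = stay-done (stay-done w⊑v)
stayˡ (step-step w⊑v) = stay-step (step-step w⊑v)

-- In the impossible cases the factorisation fails at the point 1.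
factorises-⊑ : ∀ {m k n} (w : Word m n) (v : Word k n) (u : Word m k) →
               ⟦ w ⟧ ≗ ⟦ v ⟧ ∘ ⟦ u ⟧ → w ⊑ v
factorises-⊑ done     done     done     _ = done-done
factorises-⊑ (stay w) v        (stay u) E = stayˡ (factorises-⊑ w v u (E ∘ fs))
factorises-⊑ (stay w) (stay v) (step u) E = stay-stay (factorises-⊑ w v u (E ∘ fs))
factorises-⊑ (stay w) (step v) (step u) E =
  ⊥-elim (0≢1+n (trans (sym (⟦⟧-zero w)) (E (fs fz))))
factorises-⊑ (step w) v        (stay u) E =
  ⊥-elim (0≢1+n (sym (trans (E (fs fz)) (trans (cong ⟦ v ⟧ (⟦⟧-zero u)) (⟦⟧-zero v)))))
factorises-⊑ (step w) (stay v) (step u) E =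
  ⊥-elim (0≢1+n (sym (trans (E (fs fz)) (trans (cong ⟦ v ⟧ (⟦⟧-zero u)) (⟦⟧-zero v)))))
factorises-⊑ (step w) (step v) (step u) E =
  step-step (factorises-⊑ w v u (suc-injective ∘ E ∘ fs))

⊓-source : ∀ {m k n} → Word m n → Word k n → ℕ
⊓-source done     done     = 0
⊓-source (stay w) (stay v) = suc (⊓-source w v)
⊓-source (stay w) (step v) = suc (⊓-source w (step v))
⊓-source (stay w) done     = suc (⊓-source w done)
⊓-source (step w) (stay v) = suc (⊓-source (step w) v)
⊓-source done     (stay v) = suc (⊓-source done v)
⊓-source (step w) (step v) = suc (⊓-source w v)

infixl 6 _⊓_
_⊓_ : ∀ {m k n} (w : Word m n) (v : Word k n) → Word (⊓-source w v) n
done   ⊓ done   = done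
stay w ⊓ stay v = stay (w ⊓ v)
stay w ⊓ step v = stay (w ⊓ step v)
stay w ⊓ done   = stay (w ⊓ done)
step w ⊓ stay v = stay (step w ⊓ v)
done   ⊓ stay v = stay (done ⊓ v)
step w ⊓ step v = step (w ⊓ v)

w⊓v⊑w : ∀ {m k n} (w : Word m n) (v : Word k n) → w ⊓ v ⊑ w
w⊓v⊑w done     done     = done-done
w⊓v⊑w (stay w) (stay v) = stay-stay (w⊓v⊑w w v)
w⊓v⊑w (stay w) (step v) = stay-stay (w⊓v⊑w w (step v))
w⊓v⊑w (stay w) done     = stay-stay (w⊓v⊑w w done)
w⊓v⊑w (step w) (stay v) = stay-step (w⊓v⊑w (step w) v)
w⊓v⊑w done     (stay v) = stay-done (w⊓v⊑w done v)
w⊓v⊑w (step w) (step v) = step-step (w⊓v⊑w w v)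

w⊓v⊑v : ∀ {m k n} (w : Word m n) (v : Word k n) → w ⊓ v ⊑ v
w⊓v⊑v done     done     = done-done
w⊓v⊑v (stay w) (stay v) = stay-stay (w⊓v⊑v w v)
w⊓v⊑v (stay w) (step v) = stay-step (w⊓v⊑v w (step v))
w⊓v⊑v (stay w) done     = stay-done (w⊓v⊑v w done)
w⊓v⊑v (step w) (stay v) = stay-stay (w⊓v⊑v (step w) v)
w⊓v⊑v done     (stay v) = stay-stay (w⊓v⊑v done v)
w⊓v⊑v (step w) (step v) = step-step (w⊓v⊑v w v)

⊓-glb : ∀ {j m k n} {x : Word j n} (w : Word m n) (v : Word k n) → x ⊑ w → x ⊑ v → x ⊑ w ⊓ v
⊓-glb done     done     x⊑w           _             = x⊑w
⊓-glb (stay w) (stay v) (stay-stay a) (stay-stay b) = stay-stay (⊓-glb w v a b)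
⊓-glb (stay w) (step v) (stay-stay a) (stay-step b) = stay-stay (⊓-glb w (step v) a b)
⊓-glb (stay w) done     (stay-stay a) (stay-done b) = stay-stay (⊓-glb w done a b)
⊓-glb (step w) (stay v) (stay-step a) (stay-stay b) = stay-stay (⊓-glb (step w) v a b)
⊓-glb done     (stay v) (stay-done a) (stay-stay b) = stay-stay (⊓-glb done v a b)
⊓-glb (step w) (step v) (step-step a) (step-step b) = step-step (⊓-glb w v a b)
⊓-glb (step w) (step v) (stay-step a) (stay-step b) = stay-step (⊓-glb (step w) (step v) a b)

⌜_⌝ : ∀ {m n} → Word m n → Deg n
⌜_⌝ {m} w = m , toHom w

idHom : ∀ {m} → Hom m m
idHom = hom id (λ _ _ i≤j → i≤j) (λ y → y , refl)

_∘ʰ_ : ∀ {j m n} → Hom m n → Hom j m → Hom j n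
g ∘ʰ h = hom (fun g ∘ fun h) (λ i j i≤j → mono g _ _ (mono h i j i≤j)) surj′
  where
  surj′ : Surjective (fun g ∘ fun h)
  surj′ y with surj g y
  ... | z , gz≡y with surj h z
  ...   | x , hx≡z = x , trans (cong (fun g) hx≡z) gz≡y

≼-refl : ∀ {n} {d : Deg n} → d ≼ d
≼-refl = idHom , λ _ → refl

≼-trans : ∀ {n} {a b c : Deg n} → a ≼ b → b ≼ c → a ≼ c
≼-trans (h , a≗bh) (h′ , b≗ch′) = h′ ∘ʰ h , λ x → trans (a≗bh x) (b≗ch′ _)

≼-preorder : ℕ → Preorder 0ℓ 0ℓ 0ℓ
≼-preorder n = record
  { Carrier    = Deg n
  ; _≈_        = _≡_
  ; _≲_        = _≼_
  ; isPreorder = record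
    { isEquivalence = isEquivalence
    ; reflexive     = λ { {d} refl → ≼-refl {d = d} }
    ; trans         = λ {a} {b} {c} → ≼-trans {a = a} {b} {c}
    }
  }

⊑⇒≼ : ∀ {m k n} {w : Word m n} {v : Word k n} → w ⊑ v → ⌜ w ⌝ ≼ ⌜ v ⌝
⊑⇒≼ w⊑v with ⊑-factorises w⊑v
... | u , w≗vu = toHom u , w≗vu

≼⇒⊑ : ∀ {m k n} {w : Word m n} {v : Word k n} → ⌜ w ⌝ ≼ ⌜ v ⌝ → w ⊑ v
≼⇒⊑ {w = w} {v} (h , w≗vh) with normalForm h
... | u , u≗h = factorises-⊑ w v u (λ x → trans (w≗vh x) (cong ⟦ v ⟧ (sym (u≗h x))))

wordOf : ∀ {n} (d : Deg n) → Word (proj₁ d) n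
wordOf (_ , f) = proj₁ (normalForm f)

≼-wordOf : ∀ {n} (d : Deg n) → d ≼ ⌜ wordOf d ⌝
≼-wordOf (_ , f) = idHom , sym ∘ proj₂ (normalForm f)

wordOf-≼ : ∀ {n} (d : Deg n) → ⌜ wordOf d ⌝ ≼ d
wordOf-≼ (_ , f) = idHom , proj₂ (normalForm f)

≼⇒wordOf-⊑ : ∀ {n} {d e : Deg n} → d ≼ e → wordOf d ⊑ wordOf e
≼⇒wordOf-⊑ {n} {d} {e} d≼e = ≼⇒⊑ (begin
  ⌜ wordOf d ⌝ ≲⟨ wordOf-≼ d ⟩
  d            ≲⟨ d≼e ⟩
  e            ≲⟨ ≼-wordOf e ⟩
  ⌜ wordOf e ⌝ ∎)
  where open PreorderReasoning (≼-preorder n)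

lemma3 : (n : ℕ) → HasBinaryMeets n
lemma3 n f g = ⌜ w ⊓ v ⌝ , lowerˡ , lowerʳ , greatest
  where
  open PreorderReasoning (≼-preorder n)
  w : Word (proj₁ f) n
  w = wordOf f
  v : Word (proj₁ g) n
  v = wordOf g
  lowerˡ : ⌜ w ⊓ v ⌝ ≼ f
  lowerˡ = begin ⌜ w ⊓ v ⌝ ≲⟨ ⊑⇒≼ (w⊓v⊑w w v) ⟩ ⌜ w ⌝ ≲⟨ wordOf-≼ f ⟩ f ∎
  lowerʳ : ⌜ w ⊓ v ⌝ ≼ g
  lowerʳ = begin ⌜ w ⊓ v ⌝ ≲⟨ ⊑⇒≼ (w⊓v⊑v w v) ⟩ ⌜ v ⌝ ≲⟨ wordOf-≼ g ⟩ g ∎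
  greatest : (h : Deg n) → h ≼ f → h ≼ g → h ≼ ⌜ w ⊓ v ⌝
  greatest h h≼f h≼g = begin
    h                ≲⟨ ≼-wordOf h ⟩
    ⌜ wordOf h ⌝     ≲⟨ ⊑⇒≼ (⊓-glb w v (≼⇒wordOf-⊑ h≼f) (≼⇒wordOf-⊑ h≼g)) ⟩
    ⌜ w ⊓ v ⌝        ∎
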